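{- An involution $\sigma\in\mathfrak S_n$ is shallow if and only if $\Phi(\sigma)$ avoids the vincular pattern $31,42$. Moreover, the number of shallow involutions in $\mathfrak S_n$ is the $n$th Motzkin number $M_n$ (where $M_0=M_1=1$, $M_2=2$, $M_3=4$, $M_4=9,\dots$, i.e. the number of ways to draw non-intersecting chords between $n$ points on a circle).
   Context: For $\sigma\in\mathfrak S_n$: the length $\ell_S(\sigma)$ is the number of inversions; the reflection length is $\ell_T(\sigma)=n-(\text{number of cycles of }\sigma)$; the depth is $\mathrm{dp}(\sigma)=\sum_{i:\sigma_i>i}(\sigma_i-i)$. $\sigma$ is shallow if $\mathrm{dp}(\sigma)=(\ell_S(\sigma)+\ell_T(\sigma))/2$. The fundamental bijection $\Phi$: write $\sigma$ in cycle notation with each cycle beginning with its largest element and the cycles ordered by increasing largest element; erasing parentheses gives the one-line notation of $\Phi(\sigma)$. An occurrence of the vincular pattern $31,42$ in $\tau\in\mathfrak S_n$ is a pair of positions $i,j$ with $i+1<j$ such that $\tau_{i+1}<\tau_{j+1}<\tau_i<\tau_j$; $\tau$ avoids it if there is no such occurrence. -}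

module Defs where

open import Data.Nat using (ℕ; zero; suc; _+_; _*_; _∸_; _<_; _<?_)
open import Data.Nat.Properties using (_≟_)
open import Data.Fin using (Fin; toℕ)
open import Data.Fin.Properties using (all?)
open import Data.Vec using (Vec; lookup)
open import Data.Nat.ListAction using (sum)
open import Data.List using (List; []; _∷_; _++_; map; concatMap; filter; takeWhile; length; zipWith; reverse; allFin; upTo; cartesianProduct)
import Data.List as L
open import Data.Product using (Σ; ∃; _×_; _,_)
open import Relation.Binary.PropositionalEquality using (_≡_)
open import Relation.Nullary using (¬_; Dec)
open import Relation.Nullary.Decidable using (¬?; _×-dec_)
import Data.Fin.Properties as FP
import Data.Vec as V
open import Data.List.Relation.Unary.All using (All)
import Data.List.Relation.Unary.All as All

-- A permutation σ ∈ 𝔖_n is represented by its one-line notation, a vector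
-- w : Vec (Fin n) n, with σ(i) = lookup w i (values 0-based; all statistics
-- below are invariant under the shift 1..n ↦ 0..n-1).

Word : ℕ → Set
Word n = Vec (Fin n) n

app : ∀ {n} → Word n → Fin n → Fin n
app w i = lookup w i

-- σ is an involution: σ∘σ = id (this already forces σ to be a permutation)
IsInvolution : ∀ {n} → Word n → Set
IsInvolution w = ∀ i → app w (app w i) ≡ i

isInvolution? : ∀ {n} (w : Word n) → Dec (IsInvolution w)
isInvolution? w = all? (λ i → app w (app w i) FP.≟ i)

iter : ∀ {n} → Word n → ℕ → Fin n → Fin n
iter w zero    i = i
iter w (suc k) i = app w (iter w k i)

count : ∀ {a p} {A : Set a} {P : A → Set p} → (∀ x → Dec (P x)) → List A → ℕ
count P? xs = length (filter P? xs)

lenS : ∀ {n} → Word n → ℕ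
lenS {n} w = count (λ ij → (toℕ (Data.Product.proj₁ ij) <? toℕ (Data.Product.proj₂ ij))
                           ×-dec (toℕ (app w (Data.Product.proj₂ ij)) <? toℕ (app w (Data.Product.proj₁ ij))))
                   (cartesianProduct (allFin n) (allFin n))

-- i is the largest element of its cycle: σ^k(i) ≤ i for all k < n
-- (every cycle has length ≤ n, so this ranges over the whole cycle)
IsCycleMax : ∀ {n} → Word n → Fin n → Set
IsCycleMax {n} w i = All (λ k → ¬ (toℕ i < toℕ (iter w k i))) (upTo n)

isCycleMax? : ∀ {n} (w : Word n) (i : Fin n) → Dec (IsCycleMax w i)
isCycleMax? {n} w i = All.all? (λ k → ¬? (toℕ i <? toℕ (iter w k i))) (upTo n)

-- number of cycles = number of cycle maxima (each cycle has exactly one)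
numCycles : ∀ {n} → Word n → ℕ
numCycles {n} w = count (isCycleMax? w) (allFin n)

lenT : ∀ {n} → Word n → ℕ
lenT {n} w = n ∸ numCycles w

-- depth dp(σ) = Σ_{i : σ_i > i} (σ_i − i)   (truncated subtraction gives 0 otherwise)
depth : ∀ {n} → Word n → ℕ
depth {n} w = sum (map (λ i → toℕ (app w i) ∸ toℕ i) (allFin n))

-- shallow: dp(σ) = (ℓ_S(σ) + ℓ_T(σ)) / 2, stated without division
Shallow : ∀ {n} → Word n → Set
Shallow w = 2 * depth w ≡ lenS w + lenT w

shallow? : ∀ {n} (w : Word n) → Dec (Shallow w)
shallow? w = (2 * depth w) ≟ (lenS w + lenT w)

cycleFrom : ∀ {n} → Word n → Fin n → List (Fin n)
cycleFrom {n} w m = m ∷ takeWhile (λ x → ¬? (x FP.≟ m)) (map (λ k → iter w (suc k) m) (upTo n))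

-- fundamental bijection Φ: cycles each starting at their largest element,
-- ordered by increasing largest element, parentheses erased
Φ : ∀ {n} → Word n → List ℕ
Φ {n} w = map toℕ (concatMap (cycleFrom w) (filter (isCycleMax? w) (allFin n)))

-- an occurrence of the vincular pattern 31,42: positions i, j with i+1 < j and
-- τ_{i+1} < τ_{j+1} < τ_i < τ_j; equivalently τ = xs ++ a b ++ ys ++ c d ++ zs
-- with b < d < a < c (a at i, b at i+1, c at j, d at j+1; i+1 < j is automatic)
Occurs3142 : List ℕ → Set
Occurs3142 τ = ∃ λ (xs : List ℕ) → ∃ λ a → ∃ λ b → ∃ λ (ys : List ℕ) → ∃ λ c → ∃ λ d → ∃ λ (zs : List ℕ) →
  (τ ≡ xs ++ a ∷ b ∷ ys ++ c ∷ d ∷ zs) × (b < d) × (d < a) × (a < c)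

Avoids3142 : List ℕ → Set
Avoids3142 τ = ¬ Occurs3142 τ

allVecs : (n k : ℕ) → List (Vec (Fin n) k)
allVecs n zero    = V.[] ∷ []
allVecs n (suc k) = concatMap (λ x → map (x V.∷_) (allVecs n k)) (allFin n)

-- Motzkin numbers via the chord recurrence
-- M_0 = 1, M_{m+1} = M_m + Σ_{k=0}^{m-1} M_k M_{m-1-k}
-- motzkinsRev m = [M_m, M_{m-1}, …, M_0]
motzkinsRev : ℕ → List ℕ
motzkinsRev zero = 1 ∷ []
motzkinsRev (suc m) with motzkinsRev m
... | []          = []
... | (x ∷ rest)  = (x + sum (zipWith _*_ rest (reverse rest))) ∷ x ∷ rest

motzkin : ℕ → ℕ
motzkin m with motzkinsRev m
... | []      = 0
... | (x ∷ _) = x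

-- For an involution σ call (i, σ i) with i < σ i an arc; there are ℓ_T(σ) of them. Counting pairs
-- (i, j) with i ≤ j < σ i gives dp = #arcs + #nested + #crossing pairs of arcs, and splitting the
-- inversions (i, j) by the position of j relative to σ i gives ℓ_S = 2 #nested + #arcs. Hence
-- 2 dp = ℓ_S + ℓ_T + 2 #crossing, so σ is shallow iff no two arcs cross. Φ(σ) is a concatenation of
-- blocks m or m σ(m) with increasing heads m, so its descents are exactly the arcs read backwards and
-- an occurrence of 31,42 is a pair of crossing arcs. Finally, a non-crossing involution on {0,…,m}
-- either fixes 0 or matches 0 with some a + 1, enclosing a non-crossing involution of size a and
-- followed by one of size m − 1 − a: this is the Motzkin recurrence.

module Submission where

open import Defs
open import Data.Empty using (⊥; ⊥-elim)
open import Data.Fin using (Fin; toℕ; fromℕ<) renaming (zero to fzero; suc to fsuc; _<_ to _<ᶠ_; _≟_ to _≟ᶠ_)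
open import Data.Fin.Properties using (toℕ-injective; toℕ<n; toℕ-fromℕ<) renaming (<-asym to <ᶠ-asym)
open import Data.List
  using (List; []; _∷_; _++_; map; concat; concatMap; filter; length; head; reverse; zipWith; tabulate
        ; allFin; upTo; downFrom; applyUpTo; cartesianProduct; cartesianProductWith)
open import Data.List.Properties
  using (∷-injectiveˡ; ∷-injectiveʳ; ++-assoc; length-++; length-map; length-tabulate; length-applyUpTo
        ; map-∘; map-cong; map-injective; map-tabulate; map-upTo; map-concatMap; concatMap-++
        ; reverse-map; reverse-downFrom; filter-++; filter-≐; filter-none)
open import Data.List.Membership.Propositional using (_∈_; find; lose)
open import Data.List.Membership.Propositional.Properties
open import Data.List.Membership.Propositional.Properties.WithK using (unique∧set⇒bag)
open import Data.List.Relation.Binary.BagAndSetEquality using (∼bag⇒↭)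
open import Data.List.Relation.Binary.Disjoint.Propositional using (Disjoint)
open import Data.List.Relation.Binary.Permutation.Propositional.Properties using (↭-length)
open import Data.List.Relation.Unary.All using (All; []; _∷_)
import Data.List.Relation.Unary.All as All
import Data.List.Relation.Unary.All.Properties as All
open import Data.List.Relation.Unary.AllPairs using (AllPairs; []; _∷_)
import Data.List.Relation.Unary.AllPairs as AllPairs
import Data.List.Relation.Unary.AllPairs.Properties as AllPairs
open import Data.List.Relation.Unary.Any using (here; there)
open import Data.List.Relation.Unary.Unique.Propositional using (Unique)
import Data.List.Relation.Unary.Unique.Propositional.Properties as Unique
open import Data.Maybe using (fromMaybe)
open import Data.Nat using (ℕ; zero; suc; _+_; _*_; _∸_; _≤_; _<_; z≤n; s≤s; _≤?_; _<?_; _≟_)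
open import Data.Nat.Induction using (<-rec)
open import Data.Nat.ListAction using (sum)
open import Data.Nat.Properties
open import Data.Nat.Tactic.RingSolver using (solve-∀)
open import Data.Product using (Σ; ∃; ∃₂; _×_; _,_; proj₁; proj₂)
open import Data.Sum using (_⊎_; inj₁; inj₂; [_,_])
open import Data.Vec using (Vec)
import Data.Vec as Vec
import Data.Vec.Properties as Vec
open import Function.Base using (_∘_; case_of_)
open import Function.Bundles using (_⇔_; mk⇔; Equivalence)
open import Function.Properties.Equivalence using () renaming (trans to ⇔-trans; sym to ⇔-sym)
open import Level using (0ℓ)
open import Relation.Binary.Core using (Rel)
open import Relation.Binary.Definitions using (Asymmetric; tri<; tri≈; tri>)
open import Relation.Binary.PropositionalEquality hiding ([_])
open import Relation.Nullary using (¬_; yes; no)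
open import Relation.Nullary.Decidable using (_×-dec_)
open import Relation.Unary using (Pred; Decidable; _⊆_; _≐_; ∁)
open import Relation.Unary.Properties using (∁?)

private variable
  A B : Set

-- Counting

unique∧set⇒length≡ : {xs ys : List A} → Unique xs → Unique ys →
  (∀ {x} → x ∈ xs → x ∈ ys) → (∀ {x} → x ∈ ys → x ∈ xs) → length xs ≡ length ys
unique∧set⇒length≡ uxs uys xs⊆ys ys⊆xs = ↭-length (∼bag⇒↭ (unique∧set⇒bag uxs uys (mk⇔ xs⊆ys ys⊆xs)))

count-≐ : {P Q : Pred A 0ℓ} (P? : Decidable P) (Q? : Decidable Q) → P ≐ Q → ∀ xs → count P? xs ≡ count Q? xs
count-≐ P? Q? P≐Q xs = cong length (filter-≐ P? Q? P≐Q xs)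

count-disjoint-∪ : {P Q R : Pred A 0ℓ} (P? : Decidable P) (Q? : Decidable Q) (R? : Decidable R) →
  (∀ {x} → P x → Q x ⊎ R x) → Q ⊆ P → R ⊆ P → (∀ {x} → Q x → R x → ⊥) →
  ∀ xs → count P? xs ≡ count Q? xs + count R? xs
count-disjoint-∪ P? Q? R? P⊆Q∪R Q⊆P R⊆P Q∩R=∅ [] = refl
count-disjoint-∪ P? Q? R? P⊆Q∪R Q⊆P R⊆P Q∩R=∅ (x ∷ xs)
  with ih ← count-disjoint-∪ P? Q? R? P⊆Q∪R Q⊆P R⊆P Q∩R=∅ xs | P? x | Q? x | R? x
... | yes _  | yes q | yes r = ⊥-elim (Q∩R=∅ q r)
... | yes _  | yes _ | no _  = cong suc ih
... | yes _  | no _  | yes _ = trans (cong suc ih) (sym (+-suc _ _))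
... | yes p  | no ¬q | no ¬r = ⊥-elim ([ ¬q , ¬r ] (P⊆Q∪R p))
... | no ¬p  | yes q | _     = ⊥-elim (¬p (Q⊆P q))
... | no ¬p  | no _  | yes r = ⊥-elim (¬p (R⊆P r))
... | no _   | no _  | no _  = ih

module _ {P : Pred A 0ℓ} (P? : Decidable P) where

  count-++ : ∀ xs ys → count P? (xs ++ ys) ≡ count P? xs + count P? ys
  count-++ xs ys = trans (cong length (filter-++ P? xs ys)) (length-++ (filter P? xs))

  count-∁ : ∀ xs → count P? xs + count (∁? P?) xs ≡ length xs
  count-∁ [] = refl
  count-∁ (x ∷ xs) with P? x
  ... | yes _ = cong suc (count-∁ xs)
  ... | no _  = trans (+-suc _ _) (cong suc (count-∁ xs))

  count≡0⇒∁ : ∀ {xs} → count P? xs ≡ 0 → All (∁ P) xs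
  count≡0⇒∁ {[]} _ = []
  count≡0⇒∁ {x ∷ xs} c≡0 with P? x
  ... | no ¬p = ¬p ∷ count≡0⇒∁ c≡0

  ∁⇒count≡0 : ∀ {xs} → All (∁ P) xs → count P? xs ≡ 0
  ∁⇒count≡0 none = cong length (filter-none P? none)

count-map : {P : Pred B 0ℓ} (P? : Decidable P) (f : A → B) → ∀ xs → count P? (map f xs) ≡ count (P? ∘ f) xs
count-map P? f [] = refl
count-map P? f (x ∷ xs) with P? (f x)
... | yes _ = cong suc (count-map P? f xs)
... | no _  = count-map P? f xs

count-cartesianProduct : {P : Pred (A × B) 0ℓ} (P? : Decidable P) → ∀ xs ys →
  count P? (cartesianProduct xs ys) ≡ sum (map (λ x → count (λ y → P? (x , y)) ys) xs)
count-cartesianProduct P? [] ys = refl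
count-cartesianProduct P? (x ∷ xs) ys = trans (count-++ P? (map (x ,_) ys) (cartesianProduct xs ys))
  (cong₂ _+_ (count-map P? (x ,_) ys) (count-cartesianProduct P? xs ys))

count-bijection : {P : Pred A 0ℓ} {Q : Pred B 0ℓ} (P? : Decidable P) (Q? : Decidable Q) {xs : List A} {ys : List B} →
  Unique xs → Unique ys → (f : A → B) → (∀ {x y} → f x ≡ f y → x ≡ y) →
  (∀ {x} → x ∈ xs → P x → f x ∈ ys × Q (f x)) → (∀ {y} → y ∈ ys → Q y → ∃ λ x → x ∈ xs × P x × f x ≡ y) →
  count P? xs ≡ count Q? ys
count-bijection P? Q? {xs} {ys} uxs uys f f-inj into onto =
  trans (sym (length-map f (filter P? xs)))
    (unique∧set⇒length≡ (Unique.map⁺ f-inj (Unique.filter⁺ P? uxs)) (Unique.filter⁺ Q? uys) to from)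
  where
  to : ∀ {y} → y ∈ map f (filter P? xs) → y ∈ filter Q? ys
  to y∈ with x , x∈ , refl ← ∈-map⁻ f y∈ with x∈xs , px ← ∈-filter⁻ P? x∈ =
    ∈-filter⁺ Q? (proj₁ (into x∈xs px)) (proj₂ (into x∈xs px))
  from : ∀ {y} → y ∈ filter Q? ys → y ∈ map f (filter P? xs)
  from y∈ with y∈ys , qy ← ∈-filter⁻ Q? y∈ with x , x∈xs , px , refl ← onto y∈ys qy = ∈-map⁺ f (∈-filter⁺ P? x∈xs px)

Between : ℕ → ℕ → Pred ℕ 0ℓ
Between a b x = a ≤ x × x < b

between? : ∀ a b → Decidable (Between a b)
between? a b x = (a ≤? x) ×-dec (x <? b)

count-tabulate-fsuc : ∀ {n} {P : Pred (Fin (suc n)) 0ℓ} (P? : Decidable P) →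
  count P? (tabulate fsuc) ≡ count (P? ∘ fsuc) (allFin n)
count-tabulate-fsuc {n} P? = trans (cong (count P?) (sym (map-tabulate {n = n} (λ i → i) fsuc))) (count-map P? fsuc (allFin n))

count-between : ∀ {n} a b → b ≤ n → count (between? a b ∘ toℕ) (allFin n) ≡ b ∸ a
count-between {n} a zero _ = trans (∁⇒count≡0 (between? a 0 ∘ toℕ) (All.tabulate {xs = allFin n} λ _ ())) (sym (0∸n≡0 a))
count-between {suc n} zero (suc b) (s≤s b≤n) = cong suc (trans (count-tabulate-fsuc {n} (between? 0 (suc b) ∘ toℕ))
  (trans (count-≐ (between? 0 (suc b) ∘ toℕ ∘ fsuc) (between? 0 b ∘ toℕ) shift (allFin n)) (count-between 0 b b≤n)))
  where
  shift : Between 0 (suc b) ∘ toℕ ∘ fsuc ≐ Between 0 b ∘ toℕ {n}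
  shift = (λ { (_ , s≤s j<b) → z≤n , j<b }) , (λ (_ , j<b) → z≤n , s≤s j<b)
count-between {suc n} (suc a) (suc b) (s≤s b≤n) = trans (count-tabulate-fsuc {n} (between? (suc a) (suc b) ∘ toℕ))
  (trans (count-≐ (between? (suc a) (suc b) ∘ toℕ ∘ fsuc) (between? a b ∘ toℕ) shift (allFin n)) (count-between a b b≤n))
  where
  shift : Between (suc a) (suc b) ∘ toℕ ∘ fsuc ≐ Between a b ∘ toℕ {n}
  shift = (λ { (s≤s a≤j , s≤s j<b) → a≤j , j<b }) , (λ (a≤j , j<b) → s≤s a≤j , s≤s j<b)

-- Statistics of an involution

Crossing : ∀ {n} → Word n → Set
Crossing {n} w = ∃ λ (i : Fin n) → ∃ λ (j : Fin n) →
  toℕ i < toℕ j × toℕ j < toℕ (app w i) × toℕ (app w i) < toℕ (app w j)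

module Involution {n} (w : Word n) (inv : IsInvolution w) where

  σ : Fin n → ℕ
  σ i = toℕ (app w i)

  app-injective : ∀ {i j} → app w i ≡ app w j → i ≡ j
  app-injective {i} {j} eq = trans (sym (inv i)) (trans (cong (app w) eq) (inv j))

  σ-injective : ∀ {i j} → σ i ≡ σ j → toℕ i ≡ toℕ j
  σ-injective eq = cong toℕ (app-injective (toℕ-injective eq))

  σσ : ∀ i → σ (app w i) ≡ toℕ i
  σσ i = cong toℕ (inv i)

  Pair : Set
  Pair = Fin n × Fin n

  pairs : List Pair
  pairs = cartesianProduct (allFin n) (allFin n)

  pairs-unique : Unique pairs
  pairs-unique = Unique.cartesianProduct⁺ (Unique.allFin⁺ n) (Unique.allFin⁺ n)

  ∈-pairs : ∀ p → p ∈ pairs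
  ∈-pairs (i , j) = ∈-cartesianProduct⁺ (∈-allFin i) (∈-allFin j)

  Excedance : Pred (Fin n) 0ℓ
  Excedance i = toℕ i < σ i

  DepthPair DiagonalPair InnerPair NestedPair CrossingPair : Pred Pair 0ℓ
  DepthPair    (i , j) = Between (toℕ i) (σ i) (toℕ j)
  DiagonalPair (i , j) = toℕ i ≡ toℕ j × toℕ j < σ i
  InnerPair    (i , j) = toℕ i < toℕ j × toℕ j < σ i
  NestedPair   (i , j) = InnerPair (i , j) × σ j < σ i
  CrossingPair (i , j) = InnerPair (i , j) × σ i < σ j

  Inversion InversionOutside InversionAtEnd InversionBeyond : Pred Pair 0ℓ
  Inversion        (i , j) = toℕ i < toℕ j × σ j < σ i
  InversionOutside (i , j) = toℕ i < toℕ j × σ i ≤ toℕ j × σ j < σ i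
  InversionAtEnd   (i , j) = toℕ i < toℕ j × toℕ j ≡ σ i × σ j < σ i
  InversionBeyond  (i , j) = toℕ i < toℕ j × σ i < toℕ j × σ j < σ i

  excedance? : Decidable Excedance
  excedance? i = toℕ i <? σ i

  depthPair? : Decidable DepthPair
  depthPair? (i , j) = between? (toℕ i) (σ i) (toℕ j)
  diagonalPair? : Decidable DiagonalPair
  diagonalPair? (i , j) = (toℕ i ≟ toℕ j) ×-dec (toℕ j <? σ i)
  innerPair? : Decidable InnerPair
  innerPair? (i , j) = (toℕ i <? toℕ j) ×-dec (toℕ j <? σ i)
  nestedPair? : Decidable NestedPair
  nestedPair? (i , j) = innerPair? (i , j) ×-dec (σ j <? σ i)
  crossingPair? : Decidable CrossingPair
  crossingPair? (i , j) = innerPair? (i , j) ×-dec (σ i <? σ j)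

  inversion? : Decidable Inversion
  inversion? (i , j) = (toℕ i <? toℕ j) ×-dec (σ j <? σ i)
  inversionOutside? : Decidable InversionOutside
  inversionOutside? (i , j) = (toℕ i <? toℕ j) ×-dec (σ i ≤? toℕ j) ×-dec (σ j <? σ i)
  inversionAtEnd? : Decidable InversionAtEnd
  inversionAtEnd? (i , j) = (toℕ i <? toℕ j) ×-dec (toℕ j ≟ σ i) ×-dec (σ j <? σ i)
  inversionBeyond? : Decidable InversionBeyond
  inversionBeyond? (i , j) = (toℕ i <? toℕ j) ×-dec (σ i <? toℕ j) ×-dec (σ j <? σ i)

  #excedances #nested #crossings : ℕ
  #excedances = count excedance? (allFin n)
  #nested     = count nestedPair? pairs
  #crossings  = count crossingPair? pairs

  depth≡#depthPairs : depth w ≡ count depthPair? pairs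
  depth≡#depthPairs = sym (trans (count-cartesianProduct depthPair? (allFin n) (allFin n))
    (cong sum (map-cong (λ i → count-between (toℕ i) (σ i) (<⇒≤ (toℕ<n (app w i)))) (allFin n))))

  #depthPairs≡#diagonal+#inner : count depthPair? pairs ≡ count diagonalPair? pairs + count innerPair? pairs
  #depthPairs≡#diagonal+#inner = count-disjoint-∪ depthPair? diagonalPair? innerPair?
    (λ { (i≤j , j<σi) → [ (λ i<j → inj₂ (i<j , j<σi)) , (λ i≡j → inj₁ (i≡j , j<σi)) ] (m≤n⇒m<n∨m≡n i≤j) })
    (λ (i≡j , j<σi) → ≤-reflexive i≡j , j<σi)
    (λ (i<j , j<σi) → <⇒≤ i<j , j<σi)
    (λ (i≡j , _) (i<j , _) → <-irrefl i≡j i<j)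
    pairs

  #inner≡#nested+#crossings : count innerPair? pairs ≡ #nested + #crossings
  #inner≡#nested+#crossings = count-disjoint-∪ innerPair? nestedPair? crossingPair?
    (λ { {i , j} inner → case <-cmp (σ j) (σ i) of λ where
           (tri< σj<σi _ _) → inj₁ (inner , σj<σi)
           (tri≈ _ σj≡σi _) → ⊥-elim (<-irrefl (sym (σ-injective σj≡σi)) (proj₁ inner))
           (tri> _ _ σi<σj) → inj₂ (inner , σi<σj) })
    proj₁ proj₁ (λ (_ , σj<σi) (_ , σi<σj) → <-asym σj<σi σi<σj)
    pairs

  #inversions≡#nested+#outside : lenS w ≡ #nested + count inversionOutside? pairs
  #inversions≡#nested+#outside = count-disjoint-∪ inversion? nestedPair? inversionOutside?
    (λ { {i , j} (i<j , σj<σi) → case toℕ j <? σ i of λ where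
           (yes j<σi) → inj₁ ((i<j , j<σi) , σj<σi)
           (no j≮σi)  → inj₂ (i<j , ≮⇒≥ j≮σi , σj<σi) })
    (λ ((i<j , _) , σj<σi) → i<j , σj<σi)
    (λ (i<j , _ , σj<σi) → i<j , σj<σi)
    (λ ((_ , j<σi) , _) (_ , σi≤j , _) → <⇒≱ j<σi σi≤j)
    pairs

  #outside≡#atEnd+#beyond : count inversionOutside? pairs ≡ count inversionAtEnd? pairs + count inversionBeyond? pairs
  #outside≡#atEnd+#beyond = count-disjoint-∪ inversionOutside? inversionAtEnd? inversionBeyond?
    (λ (i<j , σi≤j , σj<σi) → [ (λ σi<j → inj₂ (i<j , σi<j , σj<σi)) , (λ σi≡j → inj₁ (i<j , sym σi≡j , σj<σi)) ]
                                (m≤n⇒m<n∨m≡n σi≤j))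
    (λ (i<j , j≡σi , σj<σi) → i<j , ≤-reflexive (sym j≡σi) , σj<σi)
    (λ (i<j , σi<j , σj<σi) → i<j , <⇒≤ σi<j , σj<σi)
    (λ (_ , j≡σi , _) (_ , σi<j , _) → <-irrefl (sym j≡σi) σi<j)
    pairs

  #excedances≡#diagonal : #excedances ≡ count diagonalPair? pairs
  #excedances≡#diagonal = count-bijection excedance? diagonalPair? (Unique.allFin⁺ n) pairs-unique
    (λ i → i , i) (cong proj₁)
    (λ {i} _ i<σi → ∈-pairs (i , i) , refl , i<σi)
    (λ { {i , j} _ (i≡j , j<σi) → i , ∈-allFin i , subst (_< σ i) (sym i≡j) j<σi , cong (i ,_) (toℕ-injective i≡j) })

  #excedances≡#atEnd : #excedances ≡ count inversionAtEnd? pairs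
  #excedances≡#atEnd = count-bijection excedance? inversionAtEnd? (Unique.allFin⁺ n) pairs-unique
    (λ i → i , app w i) (cong proj₁)
    (λ {i} _ i<σi → ∈-pairs (i , app w i) , i<σi , refl , subst (_< σ i) (sym (σσ i)) i<σi)
    (λ { {i , j} _ (i<j , j≡σi , _) → i , ∈-allFin i , subst (toℕ i <_) j≡σi i<j , cong (i ,_) (toℕ-injective (sym j≡σi)) })

  #nested≡#beyond : #nested ≡ count inversionBeyond? pairs
  #nested≡#beyond = count-bijection nestedPair? inversionBeyond? pairs-unique pairs-unique
    reflect reflect-injective
    (λ { {i , j} _ ((i<j , j<σi) , σj<σi) → ∈-pairs (reflect (i , j)) ,
           σj<σi , subst (_< σ i) (sym (σσ j)) j<σi , subst₂ _<_ (sym (σσ i)) (sym (σσ j)) i<j })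
    (λ { {i , j} _ (i<j , σi<j , σj<σi) → reflect (i , j) , ∈-pairs (reflect (i , j)) ,
           ((σj<σi , subst (σ i <_) (sym (σσ j)) σi<j) , subst₂ _<_ (sym (σσ i)) (sym (σσ j)) i<j) ,
           cong₂ _,_ (inv i) (inv j) })
    where
    reflect : Pair → Pair
    reflect (i , j) = app w j , app w i
    reflect-injective : ∀ {p q} → reflect p ≡ reflect q → p ≡ q
    reflect-injective {i , j} {i′ , j′} eq = cong₂ _,_ (app-injective (cong proj₂ eq)) (app-injective (cong proj₁ eq))

  iter-involution : ∀ k i → iter w k i ≡ i ⊎ iter w k i ≡ app w i
  iter-involution zero    i = inj₁ refl
  iter-involution (suc k) i with iter-involution k i
  ... | inj₁ eq = inj₂ (cong (app w) eq)
  ... | inj₂ eq = inj₁ (trans (cong (app w) eq) (inv i))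

  cycleMax≐∁excedance : IsCycleMax w ≐ ∁ Excedance
  cycleMax≐∁excedance = max⇒¬exc , ¬exc⇒max
    where
    max⇒¬exc : ∀ {i} → IsCycleMax w i → ¬ Excedance i
    -- An excedance forces n ≥ 2, so k = 1 is among the iterates that IsCycleMax inspects.
    max⇒¬exc {i} max i<σi = All.lookup max (∈-upTo⁺ (≤-<-trans (≤-trans (s≤s z≤n) i<σi) (toℕ<n (app w i)))) i<σi
    ¬exc⇒max : ∀ {i} → ¬ Excedance i → IsCycleMax w i
    ¬exc⇒max {i} ¬i<σi = All.tabulate λ {k} _ → case iter-involution k i of λ where
      (inj₁ eq) → <-irrefl (cong toℕ (sym eq))
      (inj₂ eq) → ¬i<σi ∘ subst (λ x → toℕ i < toℕ x) eq

  lenT≡#excedances : lenT w ≡ #excedances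
  lenT≡#excedances = begin
    n ∸ numCycles w                        ≡⟨ cong (n ∸_) (count-≐ (isCycleMax? w) (∁? excedance?) cycleMax≐∁excedance (allFin n)) ⟩
    n ∸ #fixedOrFalling
      ≡⟨ cong (_∸ #fixedOrFalling) (sym (trans (count-∁ excedance? (allFin n)) (length-tabulate (λ i → i)))) ⟩
    #excedances + #fixedOrFalling ∸ #fixedOrFalling  ≡⟨ m+n∸n≡m #excedances #fixedOrFalling ⟩
    #excedances                            ∎
    where
    open ≡-Reasoning
    #fixedOrFalling = count (∁? excedance?) (allFin n)

  depth≡#excedances+#nested+#crossings : depth w ≡ #excedances + (#nested + #crossings)
  depth≡#excedances+#nested+#crossings = trans depth≡#depthPairs (trans #depthPairs≡#diagonal+#inner
             (cong₂ _+_ (sym #excedances≡#diagonal) #inner≡#nested+#crossings))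

  lenS≡#nested+#excedances+#nested : lenS w ≡ #nested + (#excedances + #nested)
  lenS≡#nested+#excedances+#nested = trans #inversions≡#nested+#outside (cong (#nested +_) (trans #outside≡#atEnd+#beyond
            (cong₂ _+_ (sym #excedances≡#atEnd) (sym #nested≡#beyond))))

  2*depth≡lenS+lenT+2*#crossings : 2 * depth w ≡ lenS w + lenT w + 2 * #crossings
  2*depth≡lenS+lenT+2*#crossings = begin
    2 * depth w                                           ≡⟨ cong (2 *_) depth≡#excedances+#nested+#crossings ⟩
    2 * (#excedances + (#nested + #crossings))            ≡⟨ regroup #excedances #nested #crossings ⟩
    #nested + (#excedances + #nested) + #excedances + 2 * #crossings
      ≡⟨ cong₂ (λ s t → s + t + 2 * #crossings) (sym lenS≡#nested+#excedances+#nested) (sym lenT≡#excedances) ⟩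
    lenS w + lenT w + 2 * #crossings                      ∎
    where
    open ≡-Reasoning
    regroup : ∀ k m c → 2 * (k + (m + c)) ≡ m + (k + m) + k + 2 * c
    regroup = solve-∀

  shallow⇔#crossings≡0 : Shallow w ⇔ #crossings ≡ 0
  shallow⇔#crossings≡0 = mk⇔
    (λ shallow → m+n≡0⇒m≡0 #crossings (+-cancelˡ-≡ (lenS w + lenT w) _ 0
       (trans (sym 2*depth≡lenS+lenT+2*#crossings) (trans shallow (sym (+-identityʳ _))))))
    (λ none → trans 2*depth≡lenS+lenT+2*#crossings (trans (cong (λ c → lenS w + lenT w + 2 * c) none) (+-identityʳ _)))

  #crossings≡0⇔¬crossing : #crossings ≡ 0 ⇔ (¬ Crossing w)
  #crossings≡0⇔¬crossing = mk⇔
    (λ none (i , j , i<j , j<σi , σi<σj) → All.lookup (count≡0⇒∁ crossingPair? none) (∈-pairs (i , j)) ((i<j , j<σi) , σi<σj))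
    (λ ¬cross → ∁⇒count≡0 crossingPair? (All.tabulate {xs = pairs}
       λ { {i , j} _ ((i<j , j<σi) , σi<σj) → ¬cross (i , j , i<j , j<σi , σi<σj) }))

  shallow⇔¬crossing : Shallow w ⇔ (¬ Crossing w)
  shallow⇔¬crossing = ⇔-trans shallow⇔#crossings≡0 #crossings≡0⇔¬crossing

-- The fundamental bijection on involutions

sorted-split : {_≺_ : Rel A 0ℓ} → Asymmetric _≺_ → ∀ {xs a c} → AllPairs _≺_ xs → a ∈ xs → c ∈ xs → a ≺ c →
  ∃ λ p → ∃₂ λ q r → xs ≡ p ++ a ∷ q ++ c ∷ r
sorted-split asym _ (here refl) (here refl) a≺a = ⊥-elim (asym a≺a a≺a)
sorted-split asym _ (here refl) (there c∈xs) _ with q , r , refl ← ∈-∃++ c∈xs = [] , q , r , refl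
sorted-split asym (x≺xs ∷ _) (there a∈xs) (here refl) a≺x = ⊥-elim (asym a≺x (All.lookup x≺xs a∈xs))
sorted-split asym (_ ∷ sorted) (there a∈xs) (there c∈xs) a≺c
  with p , q , r , refl ← sorted-split asym sorted a∈xs c∈xs a≺c = _ ∷ p , q , r , refl

cycleFrom-involution : ∀ {n} (w : Word n) → IsInvolution w → ∀ m →
  app w m ≡ m × cycleFrom w m ≡ m ∷ [] ⊎ app w m ≢ m × cycleFrom w m ≡ m ∷ app w m ∷ []
cycleFrom-involution {suc _} w inv m with app w m ≟ᶠ m
... | yes fixed = inj₁ (fixed , refl)
cycleFrom-involution {suc zero} w inv fzero | no moved with app w fzero
... | fzero = ⊥-elim (moved refl)
cycleFrom-involution {suc (suc _)} w inv m | no moved with app w (app w m) ≟ᶠ m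
... | yes _ = inj₂ (moved , refl)
... | no ¬back = ⊥-elim (¬back (inv m))

module Fundamental {n} (w : Word n) (inv : IsInvolution w) where
  open Involution w inv

  block : Fin n → List ℕ
  block m = map toℕ (cycleFrom w m)

  maxima : List (Fin n)
  maxima = filter (isCycleMax? w) (allFin n)

  Φ≡blocks : Φ w ≡ concatMap block maxima
  Φ≡blocks = map-concatMap toℕ (cycleFrom w) maxima

  maxima-sorted : AllPairs _<ᶠ_ maxima
  maxima-sorted = AllPairs.filter⁺ (isCycleMax? w) (AllPairs.tabulate⁺-< (λ i<j → i<j))

  maxima-falling : All (λ m → σ m ≤ toℕ m) maxima
  maxima-falling = All.tabulate λ m∈ → ≮⇒≥ (proj₁ cycleMax≐∁excedance (proj₂ (∈-filter⁻ (isCycleMax? w) {xs = allFin n} m∈)))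

  block-head-above : ∀ {m : Fin n} {S y ys} → All (m <ᶠ_) S → concatMap block S ≡ y ∷ ys → toℕ m < y
  block-head-above {m} (m<m′ ∷ _) eq = subst (toℕ m <_) (∷-injectiveˡ eq) m<m′

  block-shape : ∀ m → block m ≡ toℕ m ∷ [] ⊎ block m ≡ toℕ m ∷ σ m ∷ []
  block-shape m with cycleFrom-involution w inv m
  ... | inj₁ (_ , cycle≡) = inj₁ (cong (map toℕ) cycle≡)
  ... | inj₂ (_ , cycle≡) = inj₂ (cong (map toℕ) cycle≡)

  block-opener : ∀ {i} → Excedance i → block (app w i) ≡ σ i ∷ toℕ i ∷ []
  block-opener {i} i<σi with cycleFrom-involution w inv (app w i)
  ... | inj₁ (back , _)   = ⊥-elim (<-irrefl (cong toℕ (trans (sym (inv i)) back)) i<σi)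
  ... | inj₂ (_ , cycle≡) = trans (cong (map toℕ) cycle≡) (cong (λ k → σ i ∷ k ∷ []) (σσ i))

  -- Block heads increase and each block descends at most once, so a descent never straddles two blocks.
  descent⇒arc : ∀ {S} → AllPairs _<ᶠ_ S → All (λ m → σ m ≤ toℕ m) S →
    ∀ xs {x y zs} → concatMap block S ≡ xs ++ x ∷ y ∷ zs → y < x → ∃ λ m → toℕ m ≡ x × σ m ≡ y
  descent⇒arc {[]} _ _ []      ()
  descent⇒arc {[]} _ _ (_ ∷ _) ()
  descent⇒arc {m ∷ S} (m<S ∷ sorted) (σm≤m ∷ falling) xs {x} {y} {zs} eq y<x with block-shape m
  ... | inj₁ block≡ = inFixed xs (subst (λ b → b ++ concatMap block S ≡ xs ++ x ∷ y ∷ zs) block≡ eq)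
    where
    inFixed : ∀ xs → toℕ m ∷ concatMap block S ≡ xs ++ x ∷ y ∷ zs → ∃ λ m → toℕ m ≡ x × σ m ≡ y
    inFixed []       eq′ = ⊥-elim (<-asym y<x (subst (_< y) (∷-injectiveˡ eq′) (block-head-above m<S (∷-injectiveʳ eq′))))
    inFixed (_ ∷ xs) eq′ = descent⇒arc sorted falling xs (∷-injectiveʳ eq′) y<x
  ... | inj₂ block≡ = inMoved xs (subst (λ b → b ++ concatMap block S ≡ xs ++ x ∷ y ∷ zs) block≡ eq)
    where
    inMoved : ∀ xs → toℕ m ∷ σ m ∷ concatMap block S ≡ xs ++ x ∷ y ∷ zs → ∃ λ m → toℕ m ≡ x × σ m ≡ y
    inMoved []           eq′ = m , ∷-injectiveˡ eq′ , ∷-injectiveˡ (∷-injectiveʳ eq′)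
    inMoved (_ ∷ [])     eq′ = ⊥-elim (<-asym y<x (subst (_< y) (∷-injectiveˡ (∷-injectiveʳ eq′))
                                 (≤-<-trans σm≤m (block-head-above m<S (∷-injectiveʳ (∷-injectiveʳ eq′))))))
    inMoved (_ ∷ _ ∷ xs) eq′ = descent⇒arc sorted falling xs (∷-injectiveʳ (∷-injectiveʳ eq′)) y<x

  occurrence⇒crossing : Occurs3142 (Φ w) → Crossing w
  occurrence⇒crossing (xs , a , b , ys , c , d , zs , Φ≡ , b<d , d<a , a<c)
    with m₁ , m₁≡a , σm₁≡b ← descent⇒arc maxima-sorted maxima-falling xs (trans (sym Φ≡blocks) Φ≡) (<-trans b<d d<a)
       | m₂ , m₂≡c , σm₂≡d ← descent⇒arc maxima-sorted maxima-falling (xs ++ a ∷ b ∷ ys)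
           (trans (sym Φ≡blocks) (trans Φ≡ (sym (++-assoc xs (a ∷ b ∷ ys) (c ∷ d ∷ zs))))) (<-trans d<a a<c)
    = app w m₁ , app w m₂ , subst₂ _<_ (sym σm₁≡b) (sym σm₂≡d) b<d
    , subst₂ _<_ (sym σm₂≡d) (sym (trans (σσ m₁) m₁≡a)) d<a
    , subst₂ _<_ (sym (trans (σσ m₁) m₁≡a)) (sym (trans (σσ m₂) m₂≡c)) a<c

  opener∈maxima : ∀ {i} → Excedance i → app w i ∈ maxima
  opener∈maxima {i} i<σi = ∈-filter⁺ (isCycleMax? w) (∈-allFin (app w i))
    (proj₂ cycleMax≐∁excedance (λ σi<σσi → <-asym i<σi (subst (σ i <_) (σσ i) σi<σσi)))

  crossing⇒occurrence : Crossing w → Occurs3142 (Φ w)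
  crossing⇒occurrence (i , j , i<j , j<σi , σi<σj)
    with p , q , r , maxima≡ ← sorted-split <ᶠ-asym maxima-sorted
           (opener∈maxima (<-trans i<j j<σi)) (opener∈maxima (<-trans j<σi σi<σj)) σi<σj
    = concatMap block p , σ i , toℕ i , concatMap block q , σ j , toℕ j , concatMap block r , Φ≡ , i<j , j<σi , σi<σj
    where
    open ≡-Reasoning
    i<σi = <-trans i<j j<σi
    j<σj = <-trans j<σi σi<σj
    Φ≡ : Φ w ≡ concatMap block p ++ σ i ∷ toℕ i ∷ concatMap block q ++ σ j ∷ toℕ j ∷ concatMap block r
    Φ≡ = begin
      Φ w                                                          ≡⟨ Φ≡blocks ⟩
      concatMap block maxima                                       ≡⟨ cong (concatMap block) maxima≡ ⟩
      concatMap block (p ++ app w i ∷ q ++ app w j ∷ r)            ≡⟨ concatMap-++ block p _ ⟩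
      concatMap block p ++ block (app w i) ++ concatMap block (q ++ app w j ∷ r)
        ≡⟨ cong (λ l → concatMap block p ++ block (app w i) ++ l) (concatMap-++ block q _) ⟩
      concatMap block p ++ block (app w i) ++ concatMap block q ++ block (app w j) ++ concatMap block r
        ≡⟨ cong₂ (λ bi bj → concatMap block p ++ bi ++ concatMap block q ++ bj ++ concatMap block r)
             (block-opener i<σi) (block-opener j<σj) ⟩
      concatMap block p ++ σ i ∷ toℕ i ∷ concatMap block q ++ σ j ∷ toℕ j ∷ concatMap block r ∎

  avoids⇔¬crossing : Avoids3142 (Φ w) ⇔ (¬ Crossing w)
  avoids⇔¬crossing = mk⇔ (λ avoids → avoids ∘ crossing⇒occurrence) (λ ¬cross → ¬cross ∘ occurrence⇒crossing)

-- Non-crossing involutions as lists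

nth : List ℕ → ℕ → ℕ
nth []       _       = 0
nth (x ∷ _)  zero    = x
nth (_ ∷ xs) (suc i) = nth xs i

nth-map : ∀ (f : ℕ → ℕ) xs {i} → i < length xs → nth (map f xs) i ≡ f (nth xs i)
nth-map f (_ ∷ _)  {zero}  _        = refl
nth-map f (_ ∷ xs) {suc i} (s≤s i<) = nth-map f xs i<

nth-++ˡ : ∀ xs ys {i} → i < length xs → nth (xs ++ ys) i ≡ nth xs i
nth-++ˡ (_ ∷ _)  ys {zero}  _        = refl
nth-++ˡ (_ ∷ xs) ys {suc i} (s≤s i<) = nth-++ˡ xs ys i<

nth-++ʳ : ∀ xs ys i → nth (xs ++ ys) (length xs + i) ≡ nth ys i
nth-++ʳ []       ys i = refl
nth-++ʳ (_ ∷ xs) ys i = nth-++ʳ xs ys i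

nth-applyUpTo : ∀ (f : ℕ → ℕ) {n i} → i < n → nth (applyUpTo f n) i ≡ f i
nth-applyUpTo f {suc n} {zero}  _         = refl
nth-applyUpTo f {suc n} {suc i} (s≤s i<n) = nth-applyUpTo (f ∘ suc) i<n

nth-ext : ∀ {xs ys} → length xs ≡ length ys → (∀ i → i < length xs → nth xs i ≡ nth ys i) → xs ≡ ys
nth-ext {[]}     {[]}     _  _  = refl
nth-ext {x ∷ xs} {y ∷ ys} eq pt = cong₂ _∷_ (pt 0 (s≤s z≤n)) (nth-ext (suc-injective eq) (λ i i< → pt (suc i) (s≤s i<)))

record NonCrossingInvolution (m : ℕ) (l : List ℕ) : Set where
  field
    length≡     : length l ≡ m
    bounded     : ∀ i → i < m → nth l i < m
    involutive  : ∀ i → i < m → nth l (nth l i) ≡ i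
    noncrossing : ∀ {i j} → i < j → j < m → j < nth l i → nth l i < nth l j → ⊥

empty-noncrossing : NonCrossingInvolution 0 []
empty-noncrossing = record { length≡ = refl ; bounded = λ _ () ; involutive = λ _ () ; noncrossing = λ _ () }

consFixed : List ℕ → List ℕ
consFixed u = 0 ∷ map suc u

-- 0 is matched with a + 1, where a = length u; u fills the positions inside this arc and o those after it.
consArc : List ℕ → List ℕ → List ℕ
consArc o u = suc (length u) ∷ map suc u ++ 0 ∷ map (λ x → suc (suc (length u + x))) o

consFixed-valid : ∀ {m u} → NonCrossingInvolution m u → NonCrossingInvolution (suc m) (consFixed u)
consFixed-valid {m} {u} U = record
  { length≡ = cong suc (trans (length-map suc u) U.length≡) ; bounded = bounded ; involutive = involutive ; noncrossing = noncrossing }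
  where
  module U = NonCrossingInvolution U
  L = consFixed u
  at-suc : ∀ {i} → i < m → nth L (suc i) ≡ suc (nth u i)
  at-suc i<m = nth-map suc u (subst (_ <_) (sym U.length≡) i<m)
  bounded : ∀ i → i < suc m → nth L i < suc m
  bounded zero    _         = s≤s z≤n
  bounded (suc i) (s≤s i<m) = subst (_< suc m) (sym (at-suc i<m)) (s≤s (U.bounded i i<m))
  involutive : ∀ i → i < suc m → nth L (nth L i) ≡ i
  involutive zero    _         = refl
  involutive (suc i) (s≤s i<m) = trans (cong (nth L) (at-suc i<m)) (trans (at-suc (U.bounded i i<m)) (cong suc (U.involutive i i<m)))
  noncrossing : ∀ {i j} → i < j → j < suc m → j < nth L i → nth L i < nth L j → ⊥
  noncrossing {zero}  {j}     _         _         j<0 _ = n≮0 j<0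
  noncrossing {suc i} {suc j} (s≤s i<j) (s≤s j<m) j<  < =
    U.noncrossing i<j j<m (≤-pred (subst (suc j <_) (at-suc (<-trans i<j j<m)) j<))
      (≤-pred (subst₂ _<_ (at-suc (<-trans i<j j<m)) (at-suc j<m) <))

module _ (o u : List ℕ) where

  private
    a = length u
    shift : ℕ → ℕ
    shift x = suc (suc (a + x))

  consArc-length : length (consArc o u) ≡ suc (suc (a + length o))
  consArc-length = cong suc (trans (length-++ (map suc u))
    (trans (cong₂ (λ k l → k + suc l) (length-map suc u) (length-map shift o)) (+-suc a (length o))))

  consArc-inside : ∀ {i} → i < a → nth (consArc o u) (suc i) ≡ suc (nth u i)
  consArc-inside i<a = trans (nth-++ˡ (map suc u) _ (subst (_ <_) (sym (length-map suc u)) i<a)) (nth-map suc u i<a)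

  consArc-closer : nth (consArc o u) (suc a) ≡ 0
  consArc-closer = subst (λ k → nth (map suc u ++ 0 ∷ map shift o) k ≡ 0)
    (trans (+-identityʳ _) (length-map suc u)) (nth-++ʳ (map suc u) _ 0)

  consArc-outside : ∀ {j} → j < length o → nth (consArc o u) (shift j) ≡ shift (nth o j)
  consArc-outside {j} j<b = trans
    (subst (λ k → nth (map suc u ++ 0 ∷ map shift o) k ≡ nth (map shift o) j)
      (trans (cong (_+ suc j) (length-map suc u)) (+-suc a j)) (nth-++ʳ (map suc u) _ (suc j)))
    (nth-map shift o j<b)

data Position (a b : ℕ) : ℕ → Set where
  opener  : Position a b 0
  inside  : ∀ {i} → i < a → Position a b (suc i)
  closer  : Position a b (suc a)
  outside : ∀ {j} → j < b → Position a b (suc (suc (a + j)))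

position : ∀ a b {p} → p < suc (suc (a + b)) → Position a b p
position a b {zero}  _        = opener
position a b {suc p} (s≤s p<) with <-cmp p a
... | tri< p<a _ _  = inside p<a
... | tri≈ _ refl _ = closer
... | tri> _ _ a<p  = subst (Position a b) (cong suc a+j≡p)
                        (outside (+-cancelˡ-< (suc a) _ _ (subst (_< suc a + b) (sym a+j≡p) p<)))
  where a+j≡p = m+[n∸m]≡n a<p

consArc-valid : ∀ {a b o u} → NonCrossingInvolution a u → NonCrossingInvolution b o →
  NonCrossingInvolution (suc (suc (a + b))) (consArc o u)
consArc-valid {a} {b} {o} {u} U O
  with refl ← NonCrossingInvolution.length≡ U | refl ← NonCrossingInvolution.length≡ O = record
  { length≡ = consArc-length o u ; bounded = bounded ; involutive = involutive ; noncrossing = noncrossing }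
  where
  module U = NonCrossingInvolution U
  module O = NonCrossingInvolution O
  N = suc (suc (a + b))
  L = consArc o u
  shift : ℕ → ℕ
  shift x = suc (suc (a + x))
  shift-cancel-< : ∀ {x y} → shift x < shift y → x < y
  shift-cancel-< lt = +-cancelˡ-< a _ _ (≤-pred (≤-pred lt))
  a<shift : ∀ j → suc a < shift j
  a<shift j = s≤s (s≤s (m≤m+n a j))

  bounded : ∀ p → p < N → nth L p < N
  bounded p p<N with position a b p<N
  ... | opener     = a<shift b
  ... | inside i<a = subst (_< N) (sym (consArc-inside o u i<a)) (s≤s (≤-trans (U.bounded _ i<a) (≤-trans (m≤m+n a b) (n≤1+n _))))
  ... | closer     = subst (_< N) (sym (consArc-closer o u)) (s≤s z≤n)
  ... | outside j<b = subst (_< N) (sym (consArc-outside o u j<b)) (s≤s (s≤s (+-monoʳ-< a (O.bounded _ j<b))))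

  involutive : ∀ p → p < N → nth L (nth L p) ≡ p
  involutive p p<N with position a b p<N
  ... | opener      = consArc-closer o u
  ... | inside i<a  = trans (cong (nth L) (consArc-inside o u i<a))
                        (trans (consArc-inside o u (U.bounded _ i<a)) (cong suc (U.involutive _ i<a)))
  ... | closer      = cong (nth L) (consArc-closer o u)
  ... | outside j<b = trans (cong (nth L) (consArc-outside o u j<b))
                        (trans (consArc-outside o u (O.bounded _ j<b)) (cong shift (O.involutive _ j<b)))

  noncrossing : ∀ {i j} → i < j → j < N → j < nth L i → nth L i < nth L j → ⊥
  noncrossing i<j j<N j<Li Li<Lj with position a b (<-trans i<j j<N) | position a b j<N
  ... | opener | opener       = <-irrefl refl i<j
  ... | opener | inside j<a   = <-asym (U.bounded _ j<a) (≤-pred (subst (suc a <_) (consArc-inside o u j<a) Li<Lj))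
  ... | opener | closer       = <-irrefl refl j<Li
  ... | opener | outside _    = <-asym j<Li (a<shift _)
  ... | inside _ | opener     = n≮0 i<j
  ... | inside i<a | inside j<a = U.noncrossing (≤-pred i<j) j<a
          (≤-pred (subst (_ <_) (consArc-inside o u i<a) j<Li))
          (≤-pred (subst₂ _<_ (consArc-inside o u i<a) (consArc-inside o u j<a) Li<Lj))
  ... | inside i<a | closer   = <-asym (U.bounded _ i<a) (≤-pred (subst (suc a <_) (consArc-inside o u i<a) j<Li))
  ... | inside i<a | outside _ = <-asym (≤-<-trans (≤-pred (subst (_ <_) (consArc-inside o u i<a) j<Li)) (U.bounded _ i<a))
          (<-trans (n<1+n a) (a<shift _))
  ... | closer | _            = n≮0 (subst (_ <_) (consArc-closer o u) j<Li)
  ... | outside _ | opener    = n≮0 i<j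
  ... | outside _ | inside j<a = <-asym i<j (<-trans (s≤s j<a) (a<shift _))
  ... | outside _ | closer    = <-asym i<j (a<shift _)
  ... | outside i<b | outside j<b = O.noncrossing (shift-cancel-< i<j) j<b
          (shift-cancel-< (subst (_ <_) (consArc-outside o u i<b) j<Li))
          (shift-cancel-< (subst₂ _<_ (consArc-outside o u i<b) (consArc-outside o u j<b) Li<Lj))

slice : List ℕ → ℕ → ℕ → List ℕ
slice l s k = applyUpTo (λ i → nth l (s + i) ∸ s) k

slice-entry : ∀ l s {k i} → i < k → s ≤ nth l (s + i) → s + nth (slice l s k) i ≡ nth l (s + i)
slice-entry l s i<k s≤ = trans (cong (s +_) (nth-applyUpTo _ i<k)) (m+[n∸m]≡n s≤)

slice-valid : ∀ {N l} → NonCrossingInvolution N l → ∀ s k → s + k ≤ N →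
  (∀ i → i < k → Between s (s + k) (nth l (s + i))) → NonCrossingInvolution k (slice l s k)
slice-valid {N} {l} L s k s+k≤N closed = record
  { length≡ = length-applyUpTo _ k ; bounded = bounded ; involutive = involutive ; noncrossing = noncrossing }
  where
  module L = NonCrossingInvolution L
  u = slice l s k
  entry : ∀ {i} → i < k → s + nth u i ≡ nth l (s + i)
  entry i<k = slice-entry l s i<k (proj₁ (closed _ i<k))
  shifted<N : ∀ {i} → i < k → s + i < N
  shifted<N i<k = <-≤-trans (+-monoʳ-< s i<k) s+k≤N
  bounded : ∀ i → i < k → nth u i < k
  bounded i i<k = +-cancelˡ-< s _ _ (subst (_< s + k) (sym (entry i<k)) (proj₂ (closed i i<k)))
  involutive : ∀ i → i < k → nth u (nth u i) ≡ i
  involutive i i<k = +-cancelˡ-≡ s _ _ (begin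
    s + nth u (nth u i)     ≡⟨ entry (bounded i i<k) ⟩
    nth l (s + nth u i)     ≡⟨ cong (nth l) (entry i<k) ⟩
    nth l (nth l (s + i))   ≡⟨ L.involutive (s + i) (shifted<N i<k) ⟩
    s + i                   ∎)
    where open ≡-Reasoning
  noncrossing : ∀ {i j} → i < j → j < k → j < nth u i → nth u i < nth u j → ⊥
  noncrossing i<j j<k j<ui ui<uj = L.noncrossing (+-monoʳ-< s i<j) (shifted<N j<k)
    (subst (s + _ <_) (entry i<k) (+-monoʳ-< s j<ui))
    (subst₂ _<_ (entry i<k) (entry j<k) (+-monoʳ-< s ui<uj))
    where i<k = <-trans i<j j<k

consFixed-ext : ∀ {m l u} → length l ≡ suc m → length u ≡ m → nth l 0 ≡ 0 →
  (∀ i → i < m → nth l (suc i) ≡ suc (nth u i)) → l ≡ consFixed u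
consFixed-ext {m} {l} {u} len-l len-u at-opener at-rest =
  nth-ext (trans len-l (cong suc (sym (trans (length-map suc u) len-u)))) pointwise
  where
  pointwise : ∀ p → p < length l → nth l p ≡ nth (consFixed u) p
  pointwise zero    _  = at-opener
  pointwise (suc i) i< = trans (at-rest i i<m) (sym (nth-map suc u (subst (i <_) (sym len-u) i<m)))
    where i<m = ≤-pred (subst (suc i <_) len-l i<)

consArc-ext : ∀ {a b l o u} → length u ≡ a → length o ≡ b → length l ≡ suc (suc (a + b)) →
  nth l 0 ≡ suc a → (∀ i → i < a → nth l (suc i) ≡ suc (nth u i)) → nth l (suc a) ≡ 0 →
  (∀ j → j < b → nth l (suc (suc (a + j))) ≡ suc (suc (a + nth o j))) → l ≡ consArc o u
consArc-ext {l = l} {o} {u} refl refl len-l at-opener at-inside at-closer at-outside =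
  nth-ext (trans len-l (sym (consArc-length o u))) pointwise
  where
  pointwise : ∀ p → p < length l → nth l p ≡ nth (consArc o u) p
  pointwise p p< with position (length u) (length o) (subst (p <_) len-l p<)
  ... | opener      = at-opener
  ... | inside i<a  = trans (at-inside _ i<a) (sym (consArc-inside o u i<a))
  ... | closer      = trans at-closer (sym (consArc-closer o u))
  ... | outside j<b = trans (at-outside _ j<b) (sym (consArc-outside o u j<b))

module Decompose {m l} (L : NonCrossingInvolution (suc m) l) where
  open NonCrossingInvolution L

  σ : ℕ → ℕ
  σ = nth l

  fixed-case : σ 0 ≡ 0 → ∃ λ u → NonCrossingInvolution m u × l ≡ consFixed u
  fixed-case σ0≡0 = slice l 1 m , slice-valid L 1 m ≤-refl closed ,
    consFixed-ext length≡ (length-applyUpTo _ m) σ0≡0 (λ i i<m → sym (slice-entry l 1 i<m (proj₁ (closed i i<m))))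
    where
    closed : ∀ i → i < m → Between 1 (suc m) (σ (suc i))
    closed i i<m = n≢0⇒n>0 σ≢0 , bounded (suc i) (s≤s i<m)
      where
      σ≢0 : σ (suc i) ≢ 0
      σ≢0 σ≡0 = 0≢1+n (trans (sym σ0≡0) (trans (cong σ (sym σ≡0)) (involutive (suc i) (s≤s i<m))))

  module Arc (a : ℕ) (σ0≡1+a : σ 0 ≡ suc a) where

    a<m : a < m
    a<m = ≤-pred (subst (_< suc m) σ0≡1+a (bounded 0 (s≤s z≤n)))

    b : ℕ
    b = m ∸ suc a

    a+b≡m : suc (a + b) ≡ m
    a+b≡m = m+[n∸m]≡n a<m

    σ-closer : σ (suc a) ≡ 0
    σ-closer = trans (cong σ (sym σ0≡1+a)) (involutive 0 (s≤s z≤n))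

    inner : ∀ i → i < a → Between 1 (1 + a) (σ (suc i))
    inner i i<a = n≢0⇒n>0 σ≢0 , σ<1+a
      where
      1+i<1+m = s≤s (<-trans i<a a<m)
      σ≢0 : σ (suc i) ≢ 0
      σ≢0 σ≡0 = <-irrefl (sym (suc-injective (trans (sym σ0≡1+a) (trans (cong σ (sym σ≡0)) (involutive (suc i) 1+i<1+m))))) i<a
      σ<1+a : σ (suc i) < suc a
      σ<1+a with <-cmp (σ (suc i)) (suc a)
      ... | tri< lt _ _ = lt
      ... | tri≈ _ eq _ = ⊥-elim (0≢1+n (trans (sym σ-closer) (trans (cong σ (sym eq)) (involutive (suc i) 1+i<1+m))))
      ... | tri> _ _ gt = ⊥-elim (noncrossing (s≤s z≤n) 1+i<1+m
                            (subst (suc i <_) (sym σ0≡1+a) (s≤s i<a)) (subst (_< σ (suc i)) (sym σ0≡1+a) gt))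

    outer : ∀ j → j < b → Between (2 + a) (2 + a + b) (σ (2 + a + j))
    outer j j<b = σ>1+a , subst (σ p <_) (cong suc (sym a+b≡m)) (bounded p p<1+m)
      where
      p = 2 + a + j
      p<1+m : p < suc m
      p<1+m = subst (p <_) (cong suc a+b≡m) (s≤s (s≤s (+-monoʳ-< a j<b)))
      1+a<p : suc a < p
      1+a<p = s≤s (s≤s (m≤m+n a j))
      below-impossible : ∀ q → σ p ≡ q → q < suc a → ⊥
      below-impossible zero    σp≡0   _          =
        <-irrefl (trans (sym σ0≡1+a) (trans (cong σ (sym σp≡0)) (involutive p p<1+m))) 1+a<p
      below-impossible (suc i) σp≡1+i (s≤s i<a) =
        <-asym (proj₂ (inner i i<a)) (subst (suc a <_) (trans (sym (involutive p p<1+m)) (cong σ σp≡1+i)) 1+a<p)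
      σ>1+a : suc a < σ p
      σ>1+a with <-cmp (σ p) (suc a)
      ... | tri< lt _ _ = ⊥-elim (below-impossible (σ p) refl lt)
      ... | tri≈ _ eq _ = ⊥-elim (0≢1+n (trans (sym σ-closer) (trans (cong σ (sym eq)) (involutive p p<1+m))))
      ... | tri> _ _ gt = gt

    arc-case : ∃₂ λ o u → NonCrossingInvolution a u × NonCrossingInvolution b o × l ≡ consArc o u
    arc-case = slice l (2 + a) b , slice l 1 a ,
      slice-valid L 1 a (s≤s (<⇒≤ a<m)) inner , slice-valid L (2 + a) b (≤-reflexive (cong suc a+b≡m)) outer ,
      consArc-ext (length-applyUpTo _ a) (length-applyUpTo _ b) (trans length≡ (cong suc (sym a+b≡m))) σ0≡1+a
        (λ i i<a → sym (slice-entry l 1 i<a (proj₁ (inner i i<a)))) σ-closer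
        (λ j j<b → sym (slice-entry l (2 + a) j<b (proj₁ (outer j j<b))))

  decompose : (∃ λ u → NonCrossingInvolution m u × l ≡ consFixed u) ⊎
    (∃₂ λ a b → suc (a + b) ≡ m × ∃₂ λ o u → NonCrossingInvolution a u × NonCrossingInvolution b o × l ≡ consArc o u)
  decompose with σ 0 in σ0≡
  ... | zero  = inj₁ (fixed-case σ0≡)
  ... | suc a = inj₂ (a , Arc.b a σ0≡ , Arc.a+b≡m a σ0≡ , Arc.arc-case a σ0≡)

-- Enumeration by the Motzkin recurrence

arcs : List (List ℕ) → List (List ℕ) → List (List ℕ)
arcs = cartesianProductWith consArc

-- The recursion of motzkinsRev with lists of involutions in place of their numbers, so that lengths match entrywise.
noncrossingsRev : ℕ → List (List (List ℕ))
noncrossingsRev zero = ([] ∷ []) ∷ []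
noncrossingsRev (suc m) with noncrossingsRev m
... | []       = []
... | x ∷ rest = (map consFixed x ++ concat (zipWith arcs rest (reverse rest))) ∷ x ∷ rest

noncrossings : ℕ → List (List ℕ)
noncrossings m = fromMaybe [] (head (noncrossingsRev m))

map-length-noncrossingsRev : ∀ m → map length (noncrossingsRev m) ≡ motzkinsRev m
map-length-noncrossingsRev zero = refl
map-length-noncrossingsRev (suc m) with noncrossingsRev m | motzkinsRev m | map-length-noncrossingsRev m
... | []       | _ | refl = refl
... | x ∷ rest | _ | refl = cong (_∷ length x ∷ map length rest) (begin
  length (map consFixed x ++ concat (zipWith arcs rest (reverse rest)))      ≡⟨ length-++ (map consFixed x) ⟩
  length (map consFixed x) + length (concat (zipWith arcs rest (reverse rest)))
    ≡⟨ cong₂ _+_ (length-map consFixed x) (length-concat-zipWith-arcs rest (reverse rest)) ⟩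
  length x + sum (zipWith _*_ (map length rest) (map length (reverse rest)))
    ≡⟨ cong (λ r → length x + sum (zipWith _*_ (map length rest) r)) (reverse-map length rest) ⟩
  length x + sum (zipWith _*_ (map length rest) (reverse (map length rest))) ∎)
  where
  open ≡-Reasoning
  length-arcs : ∀ O U → length (arcs O U) ≡ length O * length U
  length-arcs []      U = refl
  length-arcs (o ∷ O) U = trans (length-++ (map (consArc o) U)) (cong₂ _+_ (length-map (consArc o) U) (length-arcs O U))
  length-concat-zipWith-arcs : ∀ Os Us → length (concat (zipWith arcs Os Us)) ≡ sum (zipWith _*_ (map length Os) (map length Us))
  length-concat-zipWith-arcs []       _        = refl
  length-concat-zipWith-arcs (_ ∷ _)  []       = refl
  length-concat-zipWith-arcs (O ∷ Os) (U ∷ Us) = trans (length-++ (arcs O U)) (cong₂ _+_ (length-arcs O U) (length-concat-zipWith-arcs Os Us))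

length-noncrossings : ∀ m → length (noncrossings m) ≡ motzkin m
length-noncrossings m = trans (length-head (noncrossingsRev m))
  (trans (cong (fromMaybe 0 ∘ head) (map-length-noncrossingsRev m)) (sym (motzkin≡head m)))
  where
  length-head : ∀ xss → length (fromMaybe [] (head xss)) ≡ fromMaybe 0 (head (map length xss))
  length-head []      = refl
  length-head (_ ∷ _) = refl
  motzkin≡head : ∀ m → motzkin m ≡ fromMaybe 0 (head (motzkinsRev m))
  motzkin≡head m with motzkinsRev m
  ... | []    = refl
  ... | _ ∷ _ = refl

arcsOfSize : ℕ → ℕ → List (List ℕ)
arcsOfSize m a = arcs (noncrossings (m ∸ suc a)) (noncrossings a)

noncrossings-suc : ∀ m → noncrossings (suc m) ≡ map consFixed (noncrossings m) ++ concatMap (arcsOfSize m) (upTo m)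
noncrossings-suc m = trans (cong (fromMaybe [] ∘ head) (noncrossingsRev-suc m (noncrossingsRev≡ {m})))
  (cong (λ z → map consFixed (noncrossings m) ++ concat z) (begin
    zipWith arcs (map noncrossings (downFrom m)) (reverse (map noncrossings (downFrom m)))
      ≡⟨ cong₂ (zipWith arcs) downFrom≡
           (trans (sym (reverse-map noncrossings (downFrom m))) (cong (map noncrossings) (reverse-downFrom m))) ⟩
    zipWith arcs (map (λ a → noncrossings (m ∸ suc a)) (upTo m)) (map noncrossings (upTo m))
      ≡⟨ zipWith-map-self arcs (upTo m) ⟩
    map (arcsOfSize m) (upTo m) ∎))
  where
  open ≡-Reasoning
  noncrossingsRev-suc : ∀ m {x rest} → noncrossingsRev m ≡ x ∷ rest →
    noncrossingsRev (suc m) ≡ (map consFixed x ++ concat (zipWith arcs rest (reverse rest))) ∷ x ∷ rest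
  noncrossingsRev-suc m eq rewrite eq = refl
  noncrossingsRev≡ : ∀ {m} → noncrossingsRev m ≡ noncrossings m ∷ map noncrossings (downFrom m)
  noncrossingsRev≡ {zero}  = refl
  noncrossingsRev≡ {suc m} = trans step (cong (_∷ noncrossings m ∷ map noncrossings (downFrom m)) (cong (fromMaybe [] ∘ head) (sym step)))
    where step = noncrossingsRev-suc m (noncrossingsRev≡ {m})
  downFrom-as-upTo : ∀ m → downFrom m ≡ applyUpTo (λ a → m ∸ suc a) m
  downFrom-as-upTo zero    = refl
  downFrom-as-upTo (suc m) = cong (m ∷_) (downFrom-as-upTo m)
  downFrom≡ : map noncrossings (downFrom m) ≡ map (λ a → noncrossings (m ∸ suc a)) (upTo m)
  downFrom≡ = trans (cong (map noncrossings) (trans (downFrom-as-upTo m) (sym (map-upTo _ m)))) (sym (map-∘ (upTo m)))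
  zipWith-map-self : ∀ {C : Set} (f : A → A → C) {g h : ℕ → A} xs → zipWith f (map g xs) (map h xs) ≡ map (λ x → f (g x) (h x)) xs
  zipWith-map-self f []       = refl
  zipWith-map-self f (x ∷ xs) = cong (_ ∷_) (zipWith-map-self f xs)

noncrossings-sound : ∀ m {l} → l ∈ noncrossings m → NonCrossingInvolution m l
noncrossings-sound = <-rec _ sound
  where
  sound : ∀ m → (∀ {k} → k < m → ∀ {l} → l ∈ noncrossings k → NonCrossingInvolution k l) →
    ∀ {l} → l ∈ noncrossings m → NonCrossingInvolution m l
  sound zero _ (here refl) = empty-noncrossing
  sound (suc m) ih l∈ with ∈-++⁻ (map consFixed (noncrossings m)) (subst (_ ∈_) (noncrossings-suc m) l∈)
  ... | inj₁ l∈fixed with u , u∈ , refl ← ∈-map⁻ consFixed l∈fixed = consFixed-valid (ih ≤-refl u∈)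
  ... | inj₂ l∈arcs with a , a∈ , l∈a ← find (∈-concatMap⁻ (arcsOfSize m) {xs = upTo m} l∈arcs)
                    with o , u , o∈ , u∈ , refl ← ∈-cartesianProductWith⁻ consArc (noncrossings (m ∸ suc a)) (noncrossings a) l∈a =
    subst (λ k → NonCrossingInvolution k (consArc o u)) (cong suc (m+[n∸m]≡n a<m))
      (consArc-valid (ih (<-trans a<m (n<1+n m)) u∈) (ih (s≤s (m∸n≤m m (suc a))) o∈))
    where a<m = ∈-upTo⁻ a∈

noncrossings-complete : ∀ m {l} → NonCrossingInvolution m l → l ∈ noncrossings m
noncrossings-complete = <-rec _ complete
  where
  complete : ∀ m → (∀ {k} → k < m → ∀ {l} → NonCrossingInvolution k l → l ∈ noncrossings k) →
    ∀ {l} → NonCrossingInvolution m l → l ∈ noncrossings m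
  complete zero    _  {[]}    _ = here refl
  complete zero    _  {_ ∷ _} L with () ← NonCrossingInvolution.length≡ L
  complete (suc m) ih L with Decompose.decompose L
  ... | inj₁ (u , U , refl) =
    subst (consFixed u ∈_) (sym (noncrossings-suc m)) (∈-++⁺ˡ (∈-map⁺ consFixed (ih ≤-refl U)))
  ... | inj₂ (a , b , a+b≡m , o , u , U , O , refl) =
    subst (consArc o u ∈_) (sym (noncrossings-suc m)) (∈-++⁺ʳ (map consFixed (noncrossings m))
      (∈-concatMap⁺ (arcsOfSize m) (lose (∈-upTo⁺ a<m) (∈-cartesianProductWith⁺ consArc o∈ (ih (<-trans a<m (n<1+n m)) U)))))
    where
    a<m : a < m
    a<m = subst (a <_) a+b≡m (s≤s (m≤m+n a b))
    m∸1+a≡b : m ∸ suc a ≡ b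
    m∸1+a≡b = trans (cong (_∸ suc a) (sym a+b≡m)) (m+n∸m≡n (suc a) b)
    o∈ : o ∈ noncrossings (m ∸ suc a)
    o∈ = subst (λ k → o ∈ noncrossings k) (sym m∸1+a≡b) (ih (subst (_< suc m) m∸1+a≡b (s≤s (m∸n≤m m (suc a)))) O)

++-injective-length : ∀ {xs ys zs ws : List A} → length xs ≡ length ys → xs ++ zs ≡ ys ++ ws → xs ≡ ys × zs ≡ ws
++-injective-length {xs = []}     {[]}     _   eq = refl , eq
++-injective-length {xs = _ ∷ xs} {_ ∷ ys} len eq
  with refl ← ∷-injectiveˡ eq | refl , rest≡ ← ++-injective-length {xs = xs} {ys} (suc-injective len) (∷-injectiveʳ eq)
  = refl , rest≡

consFixed-injective : ∀ {u u′} → consFixed u ≡ consFixed u′ → u ≡ u′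
consFixed-injective = map-injective suc-injective ∘ ∷-injectiveʳ

consArc-injective : ∀ {o o′ u u′} → consArc o u ≡ consArc o′ u′ → o ≡ o′ × u ≡ u′
consArc-injective {o} {o′} {u} {u′} eq
  with inside≡ , outside≡ ← ++-injective-length
         (trans (length-map suc u) (trans (suc-injective (∷-injectiveˡ eq)) (sym (length-map suc u′)))) (∷-injectiveʳ eq)
  with refl ← map-injective {f = suc} suc-injective {u} {u′} inside≡
  = map-injective (λ e → +-cancelˡ-≡ (length u) _ _ (suc-injective (suc-injective e))) (∷-injectiveʳ outside≡) , refl

arcsOfSize-opener : ∀ m {a l} → l ∈ arcsOfSize m a → nth l 0 ≡ suc a
arcsOfSize-opener m {a} l∈
  with _ , u , _ , u∈ , refl ← ∈-cartesianProductWith⁻ consArc (noncrossings (m ∸ suc a)) (noncrossings a) l∈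
  = cong suc (NonCrossingInvolution.length≡ (noncrossings-sound a u∈))

noncrossings-unique : ∀ m → Unique (noncrossings m)
noncrossings-unique = <-rec _ unique
  where
  unique : ∀ m → (∀ {k} → k < m → Unique (noncrossings k)) → Unique (noncrossings m)
  unique zero    _  = [] ∷ []
  unique (suc m) ih = subst Unique (sym (noncrossings-suc m))
    (Unique.++⁺ (Unique.map⁺ consFixed-injective (ih ≤-refl))
      (Unique.concat⁺ (All.map⁺ (All.tabulate arcs-unique)) (AllPairs.map⁺ (AllPairs.map arcs-disjoint (Unique.upTo⁺ m))))
      fixed-arcs-disjoint)
    where
    arcs-unique : ∀ {a} → a ∈ upTo m → Unique (arcsOfSize m a)
    arcs-unique {a} a∈ = Unique.cartesianProductWith⁺ consArc consArc-injective
      (ih (s≤s (m∸n≤m m (suc a)))) (ih (<-trans (∈-upTo⁻ a∈) (n<1+n m)))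
    arcs-disjoint : ∀ {a b} → a ≢ b → Disjoint (arcsOfSize m a) (arcsOfSize m b)
    arcs-disjoint a≢b (l∈a , l∈b) = a≢b (suc-injective (trans (sym (arcsOfSize-opener m l∈a)) (arcsOfSize-opener m l∈b)))
    fixed-arcs-disjoint : Disjoint (map consFixed (noncrossings m)) (concatMap (arcsOfSize m) (upTo m))
    fixed-arcs-disjoint (l∈fixed , l∈arcs)
      with _ , _ , refl ← ∈-map⁻ consFixed l∈fixed
         | _ , _ , l∈a ← find (∈-concatMap⁻ (arcsOfSize m) {xs = upTo m} l∈arcs)
      = 0≢1+n (arcsOfSize-opener m l∈a)

-- Words as lists

encode : ∀ {n} → Word n → List ℕ
encode w = tabulate (toℕ ∘ app w)

nth-encode : ∀ {n} (w : Word n) i → nth (encode w) (toℕ i) ≡ toℕ (app w i)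
nth-encode w i = nth-tabulate (toℕ ∘ app w) i
  where
  nth-tabulate : ∀ {n} (f : Fin n → ℕ) i → nth (tabulate f) (toℕ i) ≡ f i
  nth-tabulate f fzero    = refl
  nth-tabulate f (fsuc i) = nth-tabulate (f ∘ fsuc) i

fin-of : ∀ {p n} → p < n → Σ (Fin n) λ i → toℕ i ≡ p
fin-of p<n = fromℕ< p<n , toℕ-fromℕ< p<n

module _ {n} (w : Word n) where

  encode-valid : IsInvolution w → ¬ Crossing w → NonCrossingInvolution n (encode w)
  encode-valid inv ¬cross = record
    { length≡ = length-tabulate _ ; bounded = bounded ; involutive = involutive ; noncrossing = noncrossing }
    where
    bounded : ∀ p → p < n → nth (encode w) p < n
    bounded p p<n with fin-of p<n
    ... | i , refl = subst (_< n) (sym (nth-encode w i)) (toℕ<n (app w i))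
    involutive : ∀ p → p < n → nth (encode w) (nth (encode w) p) ≡ p
    involutive p p<n with fin-of p<n
    ... | i , refl =
      trans (cong (nth (encode w)) (nth-encode w i)) (trans (nth-encode w (app w i)) (cong toℕ (inv i)))
    noncrossing : ∀ {p q} → p < q → q < n → q < nth (encode w) p → nth (encode w) p < nth (encode w) q → ⊥
    noncrossing {p} {q} p<q q<n q< < with fin-of q<n | fin-of (<-trans p<q q<n)
    ... | j , refl | i , refl =
      ¬cross (i , j , p<q , subst (toℕ j <_) (nth-encode w i) q< , subst₂ _<_ (nth-encode w i) (nth-encode w j) <)

  valid-encode : NonCrossingInvolution n (encode w) → IsInvolution w × ¬ Crossing w
  valid-encode L = inv , ¬cross
    where
    module L = NonCrossingInvolution L
    inv : IsInvolution w
    inv i = toℕ-injective (trans (sym (trans (cong (nth (encode w)) (nth-encode w i)) (nth-encode w (app w i))))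
                                 (L.involutive (toℕ i) (toℕ<n i)))
    ¬cross : ¬ Crossing w
    ¬cross (i , j , i<j , j<wi , wi<wj) = L.noncrossing i<j (toℕ<n j) (subst (toℕ j <_) (sym (nth-encode w i)) j<wi)
      (subst₂ _<_ (sym (nth-encode w i)) (sym (nth-encode w j)) wi<wj)

encode-injective : ∀ {n} {w w′ : Word n} → encode w ≡ encode w′ → w ≡ w′
encode-injective {w = w} {w′} eq = trans (sym (Vec.tabulate∘lookup w)) (trans (Vec.tabulate-cong pointwise) (Vec.tabulate∘lookup w′))
  where
  pointwise : ∀ i → Vec.lookup w i ≡ Vec.lookup w′ i
  pointwise i = toℕ-injective (trans (sym (nth-encode w i)) (trans (cong (λ l → nth l (toℕ i)) eq) (nth-encode w′ i)))

decode : ∀ {n} l → (∀ p → p < n → nth l p < n) → Word n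
decode l bounded = Vec.tabulate λ i → fromℕ< (bounded (toℕ i) (toℕ<n i))

encode-decode : ∀ {n} l bounded → length l ≡ n → encode {n} (decode l bounded) ≡ l
encode-decode {n} l bounded len≡ = nth-ext (trans (length-tabulate _) (sym len≡)) (λ p p< → pointwise p (subst (p <_) (length-tabulate _) p<))
  where
  pointwise : ∀ p → p < n → nth (encode (decode l bounded)) p ≡ nth l p
  pointwise p p<n with fin-of p<n
  ... | i , refl = trans (nth-encode (decode l bounded) i) (trans (cong toℕ (Vec.lookup∘tabulate entry i)) (toℕ-fromℕ< _))
    where entry = λ i → fromℕ< (bounded (toℕ i) (toℕ<n i))

allVecs-suc : ∀ n k → allVecs n (suc k) ≡ cartesianProductWith Vec._∷_ (allFin n) (allVecs n k)
allVecs-suc n k = concatMap-map (allFin n)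
  where
  concatMap-map : ∀ xs → concatMap (λ x → map (x Vec.∷_) (allVecs n k)) xs ≡ cartesianProductWith Vec._∷_ xs (allVecs n k)
  concatMap-map []       = refl
  concatMap-map (x ∷ xs) = cong (map (x Vec.∷_) (allVecs n k) ++_) (concatMap-map xs)

∈-allVecs : ∀ {n k} (v : Vec (Fin n) k) → v ∈ allVecs n k
∈-allVecs Vec.[]            = here refl
∈-allVecs {n} {suc k} (x Vec.∷ v) = subst (_ ∈_) (sym (allVecs-suc n k)) (∈-cartesianProductWith⁺ Vec._∷_ (∈-allFin x) (∈-allVecs v))

allVecs-unique : ∀ n k → Unique (allVecs n k)
allVecs-unique n zero    = [] ∷ []
allVecs-unique n (suc k) = subst Unique (sym (allVecs-suc n k))
  (Unique.cartesianProductWith⁺ Vec._∷_ Vec.∷-injective (Unique.allFin⁺ n) (allVecs-unique n k))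


#shallowInvolutions≡motzkin : ∀ n → length (filter (λ w → isInvolution? w ×-dec shallow? w) (allVecs n n)) ≡ motzkin n
#shallowInvolutions≡motzkin n = begin
  length shallowInvolutions              ≡⟨ sym (length-map encode shallowInvolutions) ⟩
  length (map encode shallowInvolutions) ≡⟨ unique∧set⇒length≡ encodings-unique (noncrossings-unique n) to from ⟩
  length (noncrossings n)                ≡⟨ length-noncrossings n ⟩
  motzkin n                              ∎
  where
  open ≡-Reasoning
  shallowInvolution? = λ (w : Word n) → isInvolution? w ×-dec shallow? w
  shallowInvolutions = filter shallowInvolution? (allVecs n n)
  encodings-unique : Unique (map encode shallowInvolutions)
  encodings-unique = Unique.map⁺ encode-injective (Unique.filter⁺ shallowInvolution? (allVecs-unique n n))
  to : ∀ {l} → l ∈ map encode shallowInvolutions → l ∈ noncrossings n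
  to l∈ with w , w∈ , refl ← ∈-map⁻ encode l∈ with _ , inv , shallow ← ∈-filter⁻ shallowInvolution? {xs = allVecs n n} w∈ =
    noncrossings-complete n (encode-valid w inv (Equivalence.to (Involution.shallow⇔¬crossing w inv) shallow))
  from : ∀ {l} → l ∈ noncrossings n → l ∈ map encode shallowInvolutions
  from {l} l∈ = subst (_∈ map encode shallowInvolutions) encode-w≡l
    (∈-map⁺ encode (∈-filter⁺ shallowInvolution? (∈-allVecs w) (inv , Equivalence.from (Involution.shallow⇔¬crossing w inv) ¬cross)))
    where
    L = noncrossings-sound n l∈
    w = decode l (NonCrossingInvolution.bounded L)
    encode-w≡l = encode-decode l (NonCrossingInvolution.bounded L) (NonCrossingInvolution.length≡ L)
    inv,¬cross = valid-encode w (subst (NonCrossingInvolution n) (sym encode-w≡l) L)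
    inv = proj₁ inv,¬cross
    ¬cross = proj₂ inv,¬cross

corollary5p1 : ((n : ℕ) (w : Word n) → IsInvolution w → (Shallow w ⇔ Avoids3142 (Φ w)))
  × ((n : ℕ) → length (filter (λ w → isInvolution? w ×-dec shallow? w) (allVecs n n)) ≡ motzkin n)
corollary5p1 = (λ n w inv → ⇔-trans (Involution.shallow⇔¬crossing w inv) (⇔-sym (Fundamental.avoids⇔¬crossing w inv)))
             , #shallowInvolutions≡motzkin
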